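{- Let $p_1<p_2<\cdots$ be the primes. Let $\mathcal{H}$ be the set of finite rooted trees (up to label-preserving isomorphism) such that: each child of the root is labeled either $p_k$ or $p_k^{ -1}$ for some $k\ge1$, and for each $k$ at most one child of the root has a label in $\{p_k,p_k^{ -1}\}$; every other non-root vertex is labeled by a prime; and no two siblings have the same label. For a vertex $v$ define recursively $E(v)=\prod_c \ell(c)^{E(c)}$ over the children $c$ of $v$, with $\ell(c)$ the label of $c$ and the empty product equal to $1$, and let the evaluation of a tree be $E(\text{root})$. Then the evaluation map is a bijection from $\mathcal{H}$ onto the set $\mathbb{Q}^+$ of positive rational numbers.
   Context: A rooted tree is a tree with a distinguished vertex, the root; children of a vertex are its neighbors farther from the root, siblings are vertices with the same parent. Children are unordered. In the paper, $\mathcal{H}$ arises as $H_\infty=\bigcup_i H_i$ with $H_i=\bigwedge_{k}\{\mathcal{R}(T_{k^{ -1}},G_i),\mathrm{root},\mathcal{R}(T_k,G_i)\}$, where $G_i$ is the forest of validly prime-labeled trees of height at most $i$, $T_k$ (resp. $T_{k^{ -1}}$) is the root with one child labeled $p_k$ (resp. $p_k^{ -1}$), $\wedge$ is grafting (identifying roots) and $\mathcal{R}(T,\mathcal{F})$ attaches each tree of $\mathcal{F}$ at the leaf of $T$. -}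

module Defs where

open import Data.Nat as ℕ using (ℕ; zero; suc; _^_)
open import Data.Integer using (+_)
open import Data.Rational as ℚ using (ℚ; 0ℚ; 1ℚ)
open import Data.Product using (_×_; _,_; proj₁; proj₂; ∃)
open import Data.Unit using (⊤)
open import Data.List using (List; []; _∷_; map)
open import Data.List.Relation.Unary.Unique.Propositional using (Unique)
open import Data.List.Relation.Binary.Permutation.Propositional using (_↭_)
open import Relation.Binary.PropositionalEquality using (_≡_)
open import Data.Nat.Primality using (Prime)

-- A (non-root) vertex together with its subtree; each child is stored with
-- its label (a natural number, required to be prime by validity).
-- Children are stored as a list; unorderedness is handled by the
-- isomorphism relation _≅_ below (permutation of children).
data Tree : Set where
  node : List (ℕ × Tree) → Tree

-- Sign of a root-child label: pos means label p, neg means label p⁻¹.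
data Sgn : Set where
  pos neg : Sgn

-- A rooted tree of the kind in 𝓗: the root is unlabeled; each child of the
-- root carries a label p or p⁻¹ (sign, p) and a subtree.
data RTree : Set where
  root : List (Sgn × ℕ × Tree) → RTree

mutual
  data _≅_ : Tree → Tree → Set where
    node : ∀ {xs ys} (zs : List (ℕ × Tree)) → xs ↭ zs → zs ≅L ys → node xs ≅ node ys

  data _≅L_ : List (ℕ × Tree) → List (ℕ × Tree) → Set where
    []  : [] ≅L []
    _∷_ : ∀ {p q s t xs ys} → p ≡ q × s ≅ t → xs ≅L ys → ((p , s) ∷ xs) ≅L ((q , t) ∷ ys)

data _≅RL_ : List (Sgn × ℕ × Tree) → List (Sgn × ℕ × Tree) → Set where
  []  : [] ≅RL []
  _∷_ : ∀ {e f p q s t xs ys} → e ≡ f × p ≡ q × s ≅ t → xs ≅RL ys →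
        ((e , p , s) ∷ xs) ≅RL ((f , q , t) ∷ ys)

data _≅R_ : RTree → RTree → Set where
  root : ∀ {xs ys} (zs : List (Sgn × ℕ × Tree)) → xs ↭ zs → zs ≅RL ys → root xs ≅R root ys

-- Validity: non-root labels are primes; no two siblings share a label;
-- at the root, the primes underlying the labels p^{±1} are pairwise distinct
-- (i.e. for each k at most one root child has label in {p_k, p_k⁻¹}).
mutual
  ValidT : Tree → Set
  ValidT (node cs) = AllValid cs × Unique (map proj₁ cs)

  AllValid : List (ℕ × Tree) → Set
  AllValid [] = ⊤
  AllValid ((p , t) ∷ cs) = Prime p × ValidT t × AllValid cs

AllValidR : List (Sgn × ℕ × Tree) → Set
AllValidR [] = ⊤
AllValidR ((e , p , t) ∷ cs) = Prime p × ValidT t × AllValidR cs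

ValidR : RTree → Set
ValidR (root cs) = AllValidR cs × Unique (map (λ c → proj₁ (proj₂ c)) cs)

mutual
  E : Tree → ℕ
  E (node cs) = EL cs

  EL : List (ℕ × Tree) → ℕ
  EL [] = 1
  EL ((p , t) ∷ cs) = (p ^ E t) ℕ.* EL cs

-- n / d as a rational (junk value 0 when d = 0, which never occurs for valid trees)
frac : ℕ → ℕ → ℚ
frac n zero = 0ℚ
frac n (suc d) = (+ n) ℚ./ suc d

factor : Sgn → ℕ → Tree → ℚ
factor pos p t = frac (p ^ E t) 1
factor neg p t = frac 1 (p ^ E t)

ERL : List (Sgn × ℕ × Tree) → ℚ
ERL [] = 1ℚ
ERL ((e , p , t) ∷ cs) = factor e p t ℚ.* ERL cs

eval : RTree → ℚ
eval (root cs) = ERL cs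

module Submission where

-- A tree of 𝓗 is the same as a pair of prime-labelled trees, the
-- numerator tree (root children labelled p) and the denominator tree (root
-- children labelled p⁻¹), whose root labels are pairwise distinct.  Its value is
-- N / D with N, D the values of these two trees, and the disjointness of their
-- labels makes N / D a fraction in lowest terms.  The theorem thereby reduces
-- to its integer version: E is a bijection from prime-labelled trees, up to
-- isomorphism, onto the positive integers (the primes dividing E are exactly
-- the labels of the root's children, and the exponent of such a prime p is the
-- value of the subtree below p).

open import Defs
open import Algebra.Bundles using (CommutativeRing)
open import Data.Empty using (⊥; ⊥-elim)
open import Data.Integer as ℤ using (+_)
open import Data.Integer.Properties using (pos-*)
open import Data.List using (List; []; _∷_; map; _++_)
import Data.List.Properties as List
open import Data.List.Membership.Propositional using (_∈_)
open import Data.List.Relation.Binary.Permutation.Propositional using (_↭_; refl; prep; swap; trans; ↭-sym; ↭⇒↭ₛ)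
import Data.List.Relation.Binary.Permutation.Propositional.Properties as Perm
import Data.List.Relation.Binary.Permutation.Setoid.Properties as PermSetoid
open import Data.List.Relation.Unary.All using (All; _∷_)
open import Data.List.Relation.Unary.All.Properties using (All¬⇒¬Any; ¬Any⇒All¬)
open import Data.List.Relation.Unary.AllPairs using ([]; _∷_)
open import Data.List.Relation.Unary.Any using (here; there)
open import Data.List.Relation.Unary.Unique.Propositional using (Unique)
import Data.List.Relation.Unary.Unique.Propositional.Properties as Unique
open import Data.Nat as ℕ using (ℕ; zero; suc; _^_; _*_; _≤_; _<_; z≤n; s≤s; NonZero; nonTrivial⇒n>1; >-nonZero)
import Data.Nat.Properties as ℕ
open import Data.Nat.Coprimality using (Coprime; coprime-divisor; recompute)
open import Data.Nat.Divisibility using (_∣_; divides; ∣-trans; ∣-antisym; m∣m*n; n∣m*n; ∣1⇒≡1; 0∣⇒≡0; _∣?_; _∣0)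
open import Data.Nat.Induction using (<-wellFounded)
open import Data.Nat.Primality using (Prime; prime; euclidsLemma; prime⇒irreducible; prime⇒nonZero; ¬prime[1])
open import Data.Nat.Primality.Factorisation using (factorise)
open import Data.Nat.Tactic.RingSolver using (solve-∀)
open import Data.Product using (_×_; _,_; proj₁; proj₂; map₁; ∃; ∃₂)
open import Data.Rational as ℚ using (ℚ; mkℚ; Positive)
import Data.Rational.Properties as ℚ
open import Data.Rational.Unnormalised as ℚᵘ using (mkℚᵘ; *≡*)
import Data.Rational.Unnormalised.Properties as ℚᵘ
open import Data.Sum using (inj₁; inj₂)
open import Data.Unit using (tt)
open import Induction.WellFounded using (Acc; acc)
open import Relation.Binary.PropositionalEquality as ≡ using (_≡_; _≢_; refl; sym; cong; cong₂; subst; setoid)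
open import Relation.Nullary using (¬_; yes; no)
open import Algebra.Properties.CommutativeSemigroup ℕ.*-commutativeSemigroup
  using () renaming (x∙yz≈y∙xz to ℕ-x*yz≡y*xz)
open import Algebra.Properties.CommutativeSemigroup
  (CommutativeRing.*-commutativeSemigroup ℚ.+-*-commutativeRing) using () renaming (x∙yz≈y∙xz to ℚ-x*yz≡y*xz)
open ≡.≡-Reasoning

prime≥2 : ∀ {p} → Prime p → 2 ≤ p
prime≥2 {p} (prime {{nt}} _) = nonTrivial⇒n>1 p {{nt}}

prime∤1 : ∀ {p} → Prime p → ¬ p ∣ 1
prime∤1 pp p∣1 = ¬prime[1] (subst Prime (∣1⇒≡1 p∣1) pp)

prime∣prime : ∀ {p q} → Prime p → Prime q → p ∣ q → p ≡ q
prime∣prime pp pq p∣q with prime⇒irreducible pq p∣q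
... | inj₁ refl = ⊥-elim (¬prime[1] pp)
... | inj₂ p≡q  = p≡q

prime∣pow : ∀ {p q} k → Prime q → q ∣ p ^ k → q ∣ p
prime∣pow zero    pq q∣1 = ⊥-elim (prime∤1 pq q∣1)
prime∣pow {p} (suc k) pq q∣pᵏ⁺¹ with euclidsLemma p (p ^ k) pq q∣pᵏ⁺¹
... | inj₁ q∣p  = q∣p
... | inj₂ q∣pᵏ = prime∣pow k pq q∣pᵏ

prime^≥1 : ∀ {p} → Prime p → ∀ k → 1 ≤ p ^ k
prime^≥1 {p} pp k = ℕ.m^n>0 p {{prime⇒nonZero pp}} k

∣-pow : ∀ {p k} → 1 ≤ k → p ∣ p ^ k
∣-pow {k = suc _} _ = m∣m*n _

∤⇒≥1 : ∀ {d m} → ¬ d ∣ m → 1 ≤ m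
∤⇒≥1 {d} {zero}  d∤0 = ⊥-elim (d∤0 (d ∣0))
∤⇒≥1 {m = suc _} _   = s≤s z≤n

n<m^n : ∀ {m} → 2 ≤ m → ∀ n → n < m ^ n
n<m^n 2≤m zero = s≤s z≤n
n<m^n {m} 2≤m (suc n) =
  ℕ.<-≤-trans (ℕ.≤-<-trans (n<m^n 2≤m n) (ℕ.m<m*n (m ^ n) m {{mⁿ≢0}} 2≤m))
              (ℕ.≤-reflexive (ℕ.*-comm (m ^ n) m))
  where
  mⁿ≢0 : NonZero (m ^ n)
  mⁿ≢0 = >-nonZero (ℕ.≤-<-trans z≤n (n<m^n 2≤m n))

q-adic-unique : ∀ {q} → Prime q → ∀ a b m n → q ^ a * m ≡ q ^ b * n →
                ¬ q ∣ m → ¬ q ∣ n → a ≡ b × m ≡ n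
q-adic-unique pq zero zero m n eq _ _ =
  refl , ≡.trans (sym (ℕ.*-identityˡ m)) (≡.trans eq (ℕ.*-identityˡ n))
q-adic-unique {q} pq (suc a) zero m n eq _ q∤n =
  ⊥-elim (q∤n (subst (q ∣_) (≡.trans eq (ℕ.*-identityˡ n)) (∣-trans (m∣m*n (q ^ a)) (m∣m*n m))))
q-adic-unique pq zero (suc b) m n eq q∤m q∤n
  with () ← proj₁ (q-adic-unique pq (suc b) zero n m (sym eq) q∤n q∤m)
q-adic-unique {q} pq (suc a) (suc b) m n eq q∤m q∤n
  = map₁ (cong suc) (q-adic-unique pq a b m n q^a*m≡q^b*n q∤m q∤n)
  where
  q^a*m≡q^b*n : q ^ a * m ≡ q ^ b * n
  q^a*m≡q^b*n = ℕ.*-cancelˡ-≡ _ _ q {{prime⇒nonZero pq}}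
    (≡.trans (sym (ℕ.*-assoc q (q ^ a) m)) (≡.trans eq (ℕ.*-assoc q (q ^ b) n)))

q-adic-decompose : ∀ {q} → Prime q → ∀ m → 1 ≤ m → ∃₂ λ a m′ → m ≡ q ^ a * m′ × ¬ q ∣ m′
q-adic-decompose {q} pq m = go m (<-wellFounded m)
  where
  go : ∀ m → Acc _<_ m → 1 ≤ m → ∃₂ λ a m′ → m ≡ q ^ a * m′ × ¬ q ∣ m′
  go m (acc rec) 1≤m with q ∣? m
  ... | no q∤m = 0 , m , sym (ℕ.*-identityˡ m) , q∤m
  ... | yes (divides zero m≡0) with () ← ℕ.<⇒≢ 1≤m (sym m≡0)
  ... | yes (divides k@(suc _) m≡k*q) =
    let a , m′ , k≡qᵃm′ , q∤m′ = go k (rec k<m) (s≤s z≤n)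
    in suc a , m′ , ≡.trans m≡k*q (≡.trans (cong (_* q) k≡qᵃm′) (reassoc (q ^ a) m′ q)) , q∤m′
    where
    k<m : k < m
    k<m = subst (k <_) (sym m≡k*q) (ℕ.m<m*n k q (prime≥2 pq))
    reassoc : ∀ x y z → x * y * z ≡ z * x * y
    reassoc = solve-∀

prime-divisor : ∀ n → 2 ≤ n → ∃ λ p → Prime p × p ∣ n
prime-divisor n@(suc _) 2≤n with factorise n
... | record { factors = [] ; isFactorisation = n≡1 } with () ← ℕ.<⇒≢ 2≤n (sym n≡1)
... | record { factors = p ∷ ps ; isFactorisation = n≡p*ps ; factorsPrime = pp ∷ _ } =
  p , pp , subst (p ∣_) (sym n≡p*ps) (m∣m*n _)

coprime-by-primes : ∀ {m n} → 1 ≤ m → (∀ {q} → Prime q → q ∣ m → q ∣ n → ⊥) → Coprime m n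
coprime-by-primes 1≤m _ {zero} (0∣m , _) with () ← ℕ.<⇒≢ 1≤m (sym (0∣⇒≡0 0∣m))
coprime-by-primes _ _ {suc zero} _ = refl
coprime-by-primes _ no-common {d@(suc (suc _))} (d∣m , d∣n)
  with q , pq , q∣d ← prime-divisor d (s≤s (s≤s z≤n)) =
  ⊥-elim (no-common pq (∣-trans q∣d d∣m) (∣-trans q∣d d∣n))

lowest-terms-unique : ∀ {a b c d} → Coprime a b → Coprime c d → 1 ≤ a →
                      a * d ≡ c * b → a ≡ c × b ≡ d
lowest-terms-unique {a} {b} {c} {d} a⊥b c⊥d 1≤a ad≡cb = a≡c , b≡d
  where
  a∣c : a ∣ c
  a∣c = coprime-divisor a⊥b (subst (a ∣_) (≡.trans ad≡cb (ℕ.*-comm c b)) (m∣m*n d))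
  c∣a : c ∣ a
  c∣a = coprime-divisor c⊥d (subst (c ∣_) (≡.trans (sym ad≡cb) (ℕ.*-comm a d)) (m∣m*n b))
  a≡c : a ≡ c
  a≡c = ∣-antisym a∣c c∣a
  b≡d : b ≡ d
  b≡d = ℕ.*-cancelˡ-≡ b d a {{>-nonZero 1≤a}}
          (≡.trans (cong (_* b) a≡c) (sym ad≡cb))

-- Multiplying fractions with nonzero denominators; checked on unnormalised
-- representatives, where multiplication is componentwise.
frac-* : ∀ a b c d → 1 ≤ b → 1 ≤ d → frac a b ℚ.* frac c d ≡ frac (a ℕ.* c) (b ℕ.* d)
frac-* a (suc b) c (suc d) _ _ = ℚ.toℚᵘ-injective
  (ℚᵘ.≃-trans (ℚ.toℚᵘ-homo-* (frac a (suc b)) (frac c (suc d)))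
  (ℚᵘ.≃-trans (ℚᵘ.*-cong (ℚ.toℚᵘ-fromℚᵘ (mkℚᵘ (+ a) b)) (ℚ.toℚᵘ-fromℚᵘ (mkℚᵘ (+ c) d)))
  (ℚᵘ.≃-trans (*≡* (cong (ℤ._* (+ suc (d ℕ.+ b ℕ.* suc d))) (sym (pos-* a c))))
              (ℚᵘ.≃-sym (ℚ.toℚᵘ-fromℚᵘ (mkℚᵘ (+ (a ℕ.* c)) (d ℕ.+ b ℕ.* suc d)))))))

frac-injective : ∀ {a b c d} → 1 ≤ b → 1 ≤ d → frac a b ≡ frac c d → a ℕ.* d ≡ c ℕ.* b
frac-injective {a} {suc b} {c} {suc d} _ _ = ℚ.normalize-injective-≃ a c (suc b) (suc d)

frac-pos : ∀ {a b} → 1 ≤ a → 1 ≤ b → Positive (frac a b)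
frac-pos {suc a} {suc b} _ _ = ℚ.normalize-pos (suc a) (suc b)

labels : List (ℕ × Tree) → List ℕ
labels = map proj₁

EL≥1 : ∀ {cs} → AllValid cs → 1 ≤ EL cs
EL≥1 {[]}           _            = s≤s z≤n
EL≥1 {(p , t) ∷ cs} (pp , _ , v) = ℕ.*-mono-≤ (prime^≥1 pp (E t)) (EL≥1 v)

E≥1 : ∀ {t} → ValidT t → 1 ≤ E t
E≥1 {node cs} (v , _) = EL≥1 v

label-prime : ∀ {x cs} → AllValid cs → x ∈ labels cs → Prime x
label-prime {cs = _ ∷ _} (pp , _ , _) (here refl) = pp
label-prime {cs = _ ∷ _} (_ , _ , v)  (there x∈)  = label-prime v x∈

label∣EL : ∀ {p cs} → AllValid cs → p ∈ labels cs → p ∣ EL cs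
label∣EL {cs = (p , t) ∷ cs} (_ , vt , _) (here refl) = ∣-trans (∣-pow (E≥1 vt)) (m∣m*n (EL cs))
label∣EL {cs = (p , t) ∷ cs} (_ , _ , v) (there m) = ∣-trans (label∣EL v m) (n∣m*n (p ^ E t))

prime∣EL⇒label : ∀ {q cs} → Prime q → AllValid cs → q ∣ EL cs → q ∈ labels cs
prime∣EL⇒label {cs = []} pq _ q∣1 = ⊥-elim (prime∤1 pq q∣1)
prime∣EL⇒label {q} {(p , t) ∷ cs} pq (pp , _ , v) q∣EL with euclidsLemma (p ^ E t) (EL cs) pq q∣EL
... | inj₁ q∣pᵏ = here (prime∣prime pq pp (prime∣pow (E t) pq q∣pᵏ))
... | inj₂ q∣rest = there (prime∣EL⇒label pq v q∣rest)

prime∤EL : ∀ {q cs} → Prime q → AllValid cs → All (q ≢_) (labels cs) → ¬ q ∣ EL cs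
prime∤EL pq v q∉cs q∣EL = All¬⇒¬Any q∉cs (prime∣EL⇒label pq v q∣EL)

EL-↭ : ∀ {cs ds} → cs ↭ ds → EL cs ≡ EL ds
EL-↭ refl                    = refl
EL-↭ (prep (p , t) cs↭ds)    = cong (p ^ E t *_) (EL-↭ cs↭ds)
EL-↭ (swap (p , t) (q , s) cs↭ds) =
  ≡.trans (ℕ-x*yz≡y*xz (p ^ E t) (q ^ E s) _) (cong (λ z → q ^ E s * (p ^ E t * z)) (EL-↭ cs↭ds))
EL-↭ (trans cs↭ds ds↭es)     = ≡.trans (EL-↭ cs↭ds) (EL-↭ ds↭es)

mutual
  E-≅ : ∀ {s t} → s ≅ t → E s ≡ E t
  E-≅ (node _ cs↭zs zs≅ds) = ≡.trans (EL-↭ cs↭zs) (EL-≅L zs≅ds)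

  EL-≅L : ∀ {cs ds} → cs ≅L ds → EL cs ≡ EL ds
  EL-≅L []                          = refl
  EL-≅L {(p , _) ∷ _} ((refl , s≅t) ∷ cs≅ds) = cong₂ (λ e r → p ^ e * r) (E-≅ s≅t) (EL-≅L cs≅ds)

AllValid-↭ : ∀ {cs ds} → cs ↭ ds → AllValid cs → AllValid ds
AllValid-↭ refl                    v                     = v
AllValid-↭ (prep _ cs↭ds)          (pp , vt , v)         = pp , vt , AllValid-↭ cs↭ds v
AllValid-↭ (swap _ _ cs↭ds)        (pp , vt , qq , vs , v) = qq , vs , pp , vt , AllValid-↭ cs↭ds v
AllValid-↭ (trans cs↭ds ds↭es)     v                     = AllValid-↭ ds↭es (AllValid-↭ cs↭ds v)

ValidT-↭ : ∀ {cs ds} → cs ↭ ds → ValidT (node cs) → ValidT (node ds)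
ValidT-↭ cs↭ds (v , u) =
  AllValid-↭ cs↭ds v , PermSetoid.Unique-resp-↭ (setoid ℕ) (↭⇒↭ₛ (Perm.map⁺ proj₁ cs↭ds)) u

pick : ∀ {A B : Set} {a : A} {xs : List (A × B)} → a ∈ map proj₁ xs →
       ∃₂ λ b xs′ → xs ↭ (a , b) ∷ xs′
pick {xs = (a , b) ∷ xs} (here refl) = b , xs , refl
pick {xs = x ∷ xs}       (there a∈xs) with b , xs′ , xs↭ ← pick a∈xs =
  b , x ∷ xs′ , trans (prep x xs↭) (swap x (_ , b) refl)

≅-cons : ∀ {p s t cs ds} → s ≅ t → node cs ≅ node ds → node ((p , s) ∷ cs) ≅ node ((p , t) ∷ ds)
≅-cons s≅t (node zs cs↭zs zs≅ds) = node (_ ∷ zs) (prep _ cs↭zs) ((refl , s≅t) ∷ zs≅ds)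

≅-↭ : ∀ {cs cs′ t} → cs ↭ cs′ → node cs′ ≅ t → node cs ≅ t
≅-↭ cs↭cs′ (node zs cs′↭zs zs≅ds) = node zs (trans cs↭cs′ cs′↭zs) zs≅ds

-- The label q of
-- a child of the second tree divides the common value, hence labels a child of
-- the first tree; comparing q-adic parts matches the two subtrees' evaluations
-- and the evaluations of the remaining siblings, and we recurse on both.
EL-injective : ∀ cs ds → ValidT (node cs) → ValidT (node ds) → EL cs ≡ EL ds → node cs ≅ node ds
EL-injective [] [] _ _ _ = node [] refl []
EL-injective ((p , _) ∷ _) [] (avc , _) _ EL≡1 =
  ⊥-elim (prime∤1 (proj₁ avc) (subst (p ∣_) EL≡1 (label∣EL avc (here refl))))
EL-injective cs ((q , node ys) ∷ ds) (avc , uc) ((pq , vt , avds) , (q∉ds ∷ uds)) EL≡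
  with node xs , cs′ , cs↭ ← pick (prime∣EL⇒label pq avc
                                    (subst (q ∣_) (sym EL≡) (label∣EL (pq , vt , avds) (here refl))))
  with (_ , vs , avcs′) , (q∉cs′ ∷ ucs′) ← ValidT-↭ cs↭ (avc , uc)
  with E≡ , EL≡′ ← q-adic-unique pq (EL xs) (EL ys) (EL cs′) (EL ds) (≡.trans (sym (EL-↭ cs↭)) EL≡)
                                 (prime∤EL pq avcs′ q∉cs′) (prime∤EL pq avds q∉ds) =
  ≅-↭ cs↭ (≅-cons (EL-injective xs ys vs vt E≡) (EL-injective cs′ ds (avcs′ , ucs′) (avds , uds) EL≡′))

Rep : ℕ → Set
Rep n = ∃ λ cs → ValidT (node cs) × EL cs ≡ n

graft : ∀ {p a m} → Prime p → ¬ p ∣ m → Rep a → Rep m → Rep (p ^ a * m)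
graft {p} pp p∤m (xs , vxs , refl) (cs , (vcs , ucs) , refl) =
  (p , node xs) ∷ cs , ((pp , vxs , vcs) , (p∉cs ∷ ucs)) , refl
  where
  p∉cs : All (p ≢_) (labels cs)
  p∉cs = ¬Any⇒All¬ (labels cs) (λ p∈cs → p∤m (label∣EL vcs p∈cs))

-- Existence: every positive integer is the evaluation of a valid tree.  Split off
-- the full power p^a of a prime divisor p; a and the cofactor are smaller than n.
EL-surjective : ∀ n → 1 ≤ n → Rep n
EL-surjective n = go n (<-wellFounded n)
  where
  go : ∀ n → Acc _<_ n → 1 ≤ n → Rep n
  go (suc zero) _ _ = [] , (tt , []) , refl
  go n@(suc (suc _)) (acc rec) 1≤n
    with p , pp , p∣n ← prime-divisor n (s≤s (s≤s z≤n))
    with q-adic-decompose pp n 1≤n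
  ... | zero , m , n≡m , p∤m = ⊥-elim (p∤m (subst (p ∣_) (≡.trans n≡m (ℕ.*-identityˡ m)) p∣n))
  ... | a@(suc a′) , m , n≡pᵃm , p∤m =
    subst Rep (sym n≡pᵃm) (graft pp p∤m (go a (rec a<n) (s≤s z≤n)) (go m (rec m<n) (∤⇒≥1 p∤m)))
    where
    m≢0 : NonZero m
    m≢0 = >-nonZero (∤⇒≥1 p∤m)
    2≤pᵃ : 2 ≤ p ^ a
    2≤pᵃ = ℕ.≤-trans (prime≥2 pp) (ℕ.m≤m*n p (p ^ a′) {{>-nonZero (prime^≥1 pp a′)}})
    a<n : a < n
    a<n = ℕ.<-≤-trans (n<m^n (prime≥2 pp) a) (subst (p ^ a ≤_) (sym n≡pᵃm) (ℕ.m≤m*n (p ^ a) m {{m≢0}}))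
    m<n : m < n
    m<n = subst (m <_) (≡.trans (ℕ.*-comm m (p ^ a)) (sym n≡pᵃm)) (ℕ.m<m*n m (p ^ a) {{m≢0}} 2≤pᵃ)

rootLabels : List (Sgn × ℕ × Tree) → List ℕ
rootLabels = map (λ c → proj₁ (proj₂ c))

-- The root children whose exponent has sign σ, with the sign forgotten.  A tree
-- of 𝓗 is thereby split into a numerator tree (part pos) and a denominator tree
-- (part neg).
part : Sgn → List (Sgn × ℕ × Tree) → List (ℕ × Tree)
part σ   []                = []
part pos ((pos , c) ∷ cs)  = c ∷ part pos cs
part pos ((neg , _) ∷ cs)  = part pos cs
part neg ((pos , _) ∷ cs)  = part neg cs
part neg ((neg , c) ∷ cs)  = c ∷ part neg cs

numer denom : List (Sgn × ℕ × Tree) → ℕ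
numer cs = EL (part pos cs)
denom cs = EL (part neg cs)

join : List (ℕ × Tree) → List (ℕ × Tree) → List (Sgn × ℕ × Tree)
join xs ys = map (pos ,_) xs ++ map (neg ,_) ys

part-⊆ : ∀ σ {x} cs → x ∈ labels (part σ cs) → x ∈ rootLabels cs
part-⊆ pos ((pos , _) ∷ cs) (here x≡p)  = here x≡p
part-⊆ pos ((pos , _) ∷ cs) (there x∈) = there (part-⊆ pos cs x∈)
part-⊆ pos ((neg , _) ∷ cs) x∈         = there (part-⊆ pos cs x∈)
part-⊆ neg ((pos , _) ∷ cs) x∈         = there (part-⊆ neg cs x∈)
part-⊆ neg ((neg , _) ∷ cs) (here x≡p)  = here x≡p
part-⊆ neg ((neg , _) ∷ cs) (there x∈) = there (part-⊆ neg cs x∈)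

part-AllValid : ∀ σ cs → AllValidR cs → AllValid (part σ cs)
part-AllValid σ   []               _             = tt
part-AllValid pos ((pos , _) ∷ cs) (pp , vt , v) = pp , vt , part-AllValid pos cs v
part-AllValid pos ((neg , _) ∷ cs) (_ , _ , v)   = part-AllValid pos cs v
part-AllValid neg ((pos , _) ∷ cs) (_ , _ , v)   = part-AllValid neg cs v
part-AllValid neg ((neg , _) ∷ cs) (pp , vt , v) = pp , vt , part-AllValid neg cs v

numer≥1 : ∀ cs → AllValidR cs → 1 ≤ numer cs
numer≥1 cs v = EL≥1 (part-AllValid pos cs v)

denom≥1 : ∀ cs → AllValidR cs → 1 ≤ denom cs
denom≥1 cs v = EL≥1 (part-AllValid neg cs v)

part-valid : ∀ σ cs → ValidR (root cs) → ValidT (node (part σ cs))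
part-valid σ cs (v , u) = part-AllValid σ cs v , unique σ cs u
  where
  avoid : ∀ {p} σ cs → All (p ≢_) (rootLabels cs) → All (p ≢_) (labels (part σ cs))
  avoid σ cs p∉ = ¬Any⇒All¬ _ (λ p∈ → All¬⇒¬Any p∉ (part-⊆ σ cs p∈))
  unique : ∀ σ cs → Unique (rootLabels cs) → Unique (labels (part σ cs))
  unique σ   []               _           = []
  unique pos ((pos , _) ∷ cs) (p∉ ∷ u)    = avoid pos cs p∉ ∷ unique pos cs u
  unique pos ((neg , _) ∷ cs) (_ ∷ u)     = unique pos cs u
  unique neg ((pos , _) ∷ cs) (_ ∷ u)     = unique neg cs u
  unique neg ((neg , _) ∷ cs) (p∉ ∷ u)    = avoid neg cs p∉ ∷ unique neg cs u

parts-disjoint : ∀ cs → ValidR (root cs) → ∀ {x} →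
                 x ∈ labels (part pos cs) → x ∈ labels (part neg cs) → ⊥
parts-disjoint ((pos , _) ∷ cs) (_ , p∉ ∷ _) (here refl) x∈ = All¬⇒¬Any p∉ (part-⊆ neg cs x∈)
parts-disjoint ((neg , _) ∷ cs) (_ , p∉ ∷ _) x∈ (here refl) = All¬⇒¬Any p∉ (part-⊆ pos cs x∈)
parts-disjoint ((pos , _) ∷ cs) ((_ , _ , v) , _ ∷ u) (there x∈) x∈′ = parts-disjoint cs (v , u) x∈ x∈′
parts-disjoint ((neg , _) ∷ cs) ((_ , _ , v) , _ ∷ u) x∈ (there x∈′) = parts-disjoint cs (v , u) x∈ x∈′

parts-coprime : ∀ cs → ValidR (root cs) → Coprime (numer cs) (denom cs)
parts-coprime cs vc = coprime-by-primes (numer≥1 cs (proj₁ vc))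
  λ pq q∣N q∣D → parts-disjoint cs vc (prime∣EL⇒label pq (part-AllValid pos cs (proj₁ vc)) q∣N)
                                      (prime∣EL⇒label pq (part-AllValid neg cs (proj₁ vc)) q∣D)

split-↭ : ∀ cs → cs ↭ join (part pos cs) (part neg cs)
split-↭ []               = refl
split-↭ ((pos , c) ∷ cs) = prep _ (split-↭ cs)
split-↭ ((neg , c) ∷ cs) =
  trans (prep _ (split-↭ cs))
        (↭-sym (Perm.shift (neg , c) (map (pos ,_) (part pos cs)) (map (neg ,_) (part neg cs))))

numer-join : ∀ xs ys → part pos (join xs ys) ≡ xs
numer-join []       ys = no-pos ys
  where
  no-pos : ∀ ys → part pos (map (neg ,_) ys) ≡ []
  no-pos []       = refl
  no-pos (_ ∷ ys) = no-pos ys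
numer-join (x ∷ xs) ys = cong (x ∷_) (numer-join xs ys)

denom-join : ∀ xs ys → part neg (join xs ys) ≡ ys
denom-join []       ys = all-neg ys
  where
  all-neg : ∀ ys → part neg (map (neg ,_) ys) ≡ ys
  all-neg []       = refl
  all-neg (y ∷ ys) = cong (y ∷_) (all-neg ys)
denom-join (_ ∷ xs) ys = denom-join xs ys

join-valid : ∀ {xs ys} → ValidT (node xs) → ValidT (node ys) →
             (∀ {x} → x ∈ labels xs → x ∈ labels ys → ⊥) → ValidR (root (join xs ys))
join-valid {xs} {ys} (vxs , uxs) (vys , uys) disjoint =
  all-valid (lift-valid pos xs vxs) (lift-valid neg ys vys) ,
  subst Unique (sym labels-join) (Unique.++⁺ uxs uys (λ (x∈xs , x∈ys) → disjoint x∈xs x∈ys))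
  where
  lift-valid : ∀ σ cs → AllValid cs → AllValidR (map (σ ,_) cs)
  lift-valid σ []       _             = tt
  lift-valid σ (_ ∷ cs) (pp , vt , v) = pp , vt , lift-valid σ cs v
  all-valid : ∀ {cs ds} → AllValidR cs → AllValidR ds → AllValidR (cs ++ ds)
  all-valid {[]}    _             w = w
  all-valid {_ ∷ _} (pp , vt , v) w = pp , vt , all-valid v w
  labels-join : rootLabels (join xs ys) ≡ labels xs ++ labels ys
  labels-join = ≡.trans (List.map-++ _ (map (pos ,_) xs) (map (neg ,_) ys))
                        (cong₂ _++_ (sym (List.map-∘ xs)) (sym (List.map-∘ ys)))

join-≅R : ∀ {xs xs′ ys ys′} → node xs ≅ node xs′ → node ys ≅ node ys′ →
          root (join xs ys) ≅R root (join xs′ ys′)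
join-≅R (node as xs↭as as≅xs′) (node bs ys↭bs bs≅ys′) =
  root (join as bs) (Perm.++⁺ (Perm.map⁺ _ xs↭as) (Perm.map⁺ _ ys↭bs))
       (++-≅RL (lift-≅RL pos as≅xs′) (lift-≅RL neg bs≅ys′))
  where
  lift-≅RL : ∀ σ {cs ds} → cs ≅L ds → map (σ ,_) cs ≅RL map (σ ,_) ds
  lift-≅RL σ []                   = []
  lift-≅RL σ ((p≡q , s≅t) ∷ cs≅ds) = (refl , p≡q , s≅t) ∷ lift-≅RL σ cs≅ds
  ++-≅RL : ∀ {cs ds cs′ ds′} → cs ≅RL ds → cs′ ≅RL ds′ → (cs ++ cs′) ≅RL (ds ++ ds′)
  ++-≅RL []         r′ = r′
  ++-≅RL (h ∷ r)    r′ = h ∷ ++-≅RL r r′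

≅RL-↭ : ∀ {xs ys ys′} → xs ≅RL ys → ys ↭ ys′ → ∃ λ xs′ → xs ↭ xs′ × xs′ ≅RL ys′
≅RL-↭ {xs} r refl = xs , refl , r
≅RL-↭ (h ∷ r) (prep _ ys↭ys′) with xs′ , xs↭xs′ , r′ ← ≅RL-↭ r ys↭ys′ =
  _ ∷ xs′ , prep _ xs↭xs′ , h ∷ r′
≅RL-↭ (h₁ ∷ h₂ ∷ r) (swap _ _ ys↭ys′) with xs′ , xs↭xs′ , r′ ← ≅RL-↭ r ys↭ys′ =
  _ ∷ _ ∷ xs′ , swap _ _ xs↭xs′ , h₂ ∷ h₁ ∷ r′
≅RL-↭ r (trans ys↭zs zs↭ys′)
  with as , xs↭as , r₁ ← ≅RL-↭ r ys↭zs
  with bs , as↭bs , r₂ ← ≅RL-↭ r₁ zs↭ys′ = bs , trans xs↭as as↭bs , r₂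

≅R-↭ˡ : ∀ {cs cs′ t} → cs ↭ cs′ → root cs′ ≅R t → root cs ≅R t
≅R-↭ˡ cs↭cs′ (root zs cs′↭zs zs≅ds) = root zs (trans cs↭cs′ cs′↭zs) zs≅ds

≅R-↭ʳ : ∀ {s ds ds′} → s ≅R root ds → ds ↭ ds′ → s ≅R root ds′
≅R-↭ʳ (root zs cs↭zs zs≅ds) ds↭ds′ with zs′ , zs↭zs′ , zs′≅ds′ ← ≅RL-↭ zs≅ds ds↭ds′ =
  root zs′ (trans cs↭zs zs↭zs′) zs′≅ds′

eval-frac : ∀ cs → AllValidR cs → ERL cs ≡ frac (numer cs) (denom cs)
eval-frac [] _ = refl
eval-frac ((pos , p , t) ∷ cs) (_ , _ , v) = begin
  frac (p ^ E t) 1 ℚ.* ERL cs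
    ≡⟨ cong (frac (p ^ E t) 1 ℚ.*_) (eval-frac cs v) ⟩
  frac (p ^ E t) 1 ℚ.* frac (numer cs) (denom cs)
    ≡⟨ frac-* (p ^ E t) 1 (numer cs) (denom cs) (s≤s z≤n) (denom≥1 cs v) ⟩
  frac (p ^ E t ℕ.* numer cs) (1 ℕ.* denom cs)
    ≡⟨ cong (frac (p ^ E t ℕ.* numer cs)) (ℕ.*-identityˡ (denom cs)) ⟩
  frac (p ^ E t ℕ.* numer cs) (denom cs)           ∎
eval-frac ((neg , p , t) ∷ cs) (pp , _ , v) = begin
  frac 1 (p ^ E t) ℚ.* ERL cs
    ≡⟨ cong (frac 1 (p ^ E t) ℚ.*_) (eval-frac cs v) ⟩
  frac 1 (p ^ E t) ℚ.* frac (numer cs) (denom cs)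
    ≡⟨ frac-* 1 (p ^ E t) (numer cs) (denom cs) (prime^≥1 pp (E t)) (denom≥1 cs v) ⟩
  frac (1 ℕ.* numer cs) (p ^ E t ℕ.* denom cs)
    ≡⟨ cong (λ a → frac a (p ^ E t ℕ.* denom cs)) (ℕ.*-identityˡ (numer cs)) ⟩
  frac (numer cs) (p ^ E t ℕ.* denom cs)           ∎

ERL-↭ : ∀ {cs ds} → cs ↭ ds → ERL cs ≡ ERL ds
ERL-↭ refl                         = refl
ERL-↭ (prep (e , p , t) cs↭ds)     = cong (factor e p t ℚ.*_) (ERL-↭ cs↭ds)
ERL-↭ (swap (e , p , t) (f , q , s) cs↭ds) =
  ≡.trans (ℚ-x*yz≡y*xz (factor e p t) (factor f q s) _)
          (cong (λ z → factor f q s ℚ.* (factor e p t ℚ.* z)) (ERL-↭ cs↭ds))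
ERL-↭ (trans cs↭ds ds↭es)          = ≡.trans (ERL-↭ cs↭ds) (ERL-↭ ds↭es)

ERL-≅RL : ∀ {cs ds} → cs ≅RL ds → ERL cs ≡ ERL ds
ERL-≅RL []                                  = refl
ERL-≅RL {(e , p , _) ∷ _} ((refl , refl , s≅t) ∷ cs≅ds) =
  cong₂ ℚ._*_ (factor-E e (E-≅ s≅t)) (ERL-≅RL cs≅ds)
  where
  factor-E : ∀ e {s t} → E s ≡ E t → factor e p s ≡ factor e p t
  factor-E pos Es≡Et = cong (λ k → frac (p ^ k) 1) Es≡Et
  factor-E neg Es≡Et = cong (λ k → frac 1 (p ^ k)) Es≡Et

eval-≅R : ∀ {s t} → s ≅R t → eval s ≡ eval t
eval-≅R (root _ cs↭zs zs≅ds) = ≡.trans (ERL-↭ cs↭zs) (ERL-≅RL zs≅ds)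

eval-positive : ∀ t → ValidR t → Positive (eval t)
eval-positive (root cs) (v , _) =
  subst Positive (sym (eval-frac cs v)) (frac-pos (numer≥1 cs v) (denom≥1 cs v))

-- Equal evaluations force equal numerators and denominators, both fractions
-- being in lowest terms.
parts-equal : ∀ cs ds → ValidR (root cs) → ValidR (root ds) → ERL cs ≡ ERL ds →
              numer cs ≡ numer ds × denom cs ≡ denom ds
parts-equal cs ds vc@(avc , _) vd@(avd , _) ERL≡ =
  lowest-terms-unique (parts-coprime cs vc) (parts-coprime ds vd) (numer≥1 cs avc)
    (frac-injective (denom≥1 cs avc) (denom≥1 ds avd)
      (≡.trans (sym (eval-frac cs avc)) (≡.trans ERL≡ (eval-frac ds avd))))

-- Injectivity: numerator and denominator trees are isomorphic by uniqueness of
-- representations of integers, and each tree is a reordering of their join.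
eval-injective : ∀ s t → ValidR s → ValidR t → eval s ≡ eval t → s ≅R t
eval-injective (root cs) (root ds) vc vd ERL≡
  with numer≡ , denom≡ ← parts-equal cs ds vc vd ERL≡ =
  ≅R-↭ʳ (≅R-↭ˡ (split-↭ cs) (join-≅R numer≅ denom≅)) (↭-sym (split-↭ ds))
  where
  numer≅ : node (part pos cs) ≅ node (part pos ds)
  numer≅ = EL-injective (part pos cs) (part pos ds) (part-valid pos cs vc) (part-valid pos ds vd) numer≡
  denom≅ : node (part neg cs) ≅ node (part neg ds)
  denom≅ = EL-injective (part neg cs) (part neg ds) (part-valid neg cs vc) (part-valid neg ds vd) denom≡

-- Surjectivity: represent numerator and denominator of a positive rational in
-- lowest terms by valid trees; coprimality makes their label sets disjoint.
eval-surjective : (q : ℚ) → Positive q → ∃ λ t → ValidR t × eval t ≡ q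
eval-surjective (mkℚ (+ suc n) d n⊥d) _
  with ns , vns , ELns≡n ← EL-surjective (suc n) (s≤s z≤n)
  with ds , vds , ELds≡d ← EL-surjective (suc d) (s≤s z≤n) =
  root (join ns ds) , valid , (begin
    ERL (join ns ds)                                 ≡⟨ eval-frac (join ns ds) (proj₁ valid) ⟩
    frac (numer (join ns ds)) (denom (join ns ds))   ≡⟨ cong₂ frac numer≡ denom≡ ⟩
    frac (suc n) (suc d)                             ≡⟨ ℚ.normalize-coprime n⊥d ⟩
    mkℚ (+ suc n) d n⊥d                              ∎)
  where
  disjoint : ∀ {x} → x ∈ labels ns → x ∈ labels ds → ⊥
  disjoint {x} x∈ns x∈ds = ¬prime[1] (subst Prime x≡1 (label-prime (proj₁ vns) x∈ns))
    where
    x≡1 : x ≡ 1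
    x≡1 = recompute n⊥d (subst (x ∣_) ELns≡n (label∣EL (proj₁ vns) x∈ns) ,
                         subst (x ∣_) ELds≡d (label∣EL (proj₁ vds) x∈ds))
  valid : ValidR (root (join ns ds))
  valid = join-valid vns vds disjoint
  numer≡ : numer (join ns ds) ≡ suc n
  numer≡ = ≡.trans (cong EL (numer-join ns ds)) ELns≡n
  denom≡ : denom (join ns ds) ≡ suc d
  denom≡ = ≡.trans (cong EL (denom-join ns ds)) ELds≡d

mainTheorem3 : ((s t : RTree) → ValidR s → ValidR t → s ≅R t → eval s ≡ eval t)
    × ((t : RTree) → ValidR t → Positive (eval t))
    × ((s t : RTree) → ValidR s → ValidR t → eval s ≡ eval t → s ≅R t)
    × ((q : ℚ) → Positive q → ∃ λ t → ValidR t × eval t ≡ q)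
mainTheorem3 = (λ _ _ _ _ → eval-≅R) , eval-positive , eval-injective , eval-surjective
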